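{- Let $N$ be a positive odd integer. For integers $r\ge s\ge 2$ put $\Phi_r^s=\Gamma_1(2^sN)\cap\Gamma_0(2^r)$, and let $U':\Phi_r^{s\,\mathrm{ab}}\to\Phi_{r+1}^{s\,\mathrm{ab}}$ be the composition of the transfer $V:\Phi_r^{s\,\mathrm{ab}}\to(\Phi_r^s\cap\Gamma^0(2))^{\mathrm{ab}}$ with the isomorphism $(\Phi_r^s\cap\Gamma^0(2))^{\mathrm{ab}}\to\Phi_{r+1}^{s\,\mathrm{ab}}$ induced by $g\mapsto tgt^{ -1}$, where $t=\begin{pmatrix}1&0\\0&2\end{pmatrix}$. Suppose $r\ge s\ge 2$, $r'\ge s'\ge 2$, $r\ge r'$ and $s\ge s'$ (so $\Phi_r^s\subset\Phi_{r'}^{s'}$). Then the square formed by $U':\Phi_r^{s\,\mathrm{ab}}\to\Phi_{r+1}^{s\,\mathrm{ab}}$, $U':\Phi_{r'}^{s'\,\mathrm{ab}}\to\Phi_{r'+1}^{s'\,\mathrm{ab}}$ and the horizontal maps $\Phi_r^{s\,\mathrm{ab}}\to\Phi_{r'}^{s'\,\mathrm{ab}}$, $\Phi_{r+1}^{s\,\mathrm{ab}}\to\Phi_{r'+1}^{s'\,\mathrm{ab}}$ induced by inclusion commutes. Consequently, the Atkin operator $U$ commutes with the morphism $\Phi_r^{s\,\mathrm{ab}}\to\Phi_{r'}^{s'\,\mathrm{ab}}$ induced by inclusion.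
   Context: $\Gamma_1(M)$: matrices in $\mathrm{SL}_2(\mathbb{Z})$ congruent to $\begin{pmatrix}1&*\\0&1\end{pmatrix}$ mod $M$; $\Gamma_0(M)$: matrices in $\mathrm{SL}_2(\mathbb{Z})$ with lower-left entry divisible by $M$; $\Gamma^0(2)$: matrices in $\mathrm{SL}_2(\mathbb{Z})$ with even upper-right entry. One has $t^{ -1}\Phi_r^st\cap\Phi_r^s=\Phi_r^s\cap\Gamma^0(2)$ and $t(\Phi_r^s\cap\Gamma^0(2))t^{ -1}=\Phi_{r+1}^s$. The Atkin operator $U\in\mathrm{End}(\Phi_r^{s\,\mathrm{ab}})$ is the composition of $U':\Phi_r^{s\,\mathrm{ab}}\to\Phi_{r+1}^{s\,\mathrm{ab}}$ with the map $\Phi_{r+1}^{s\,\mathrm{ab}}\to\Phi_r^{s\,\mathrm{ab}}$ induced by the inclusion $\Phi_{r+1}^s\subset\Phi_r^s$. $G^{\mathrm{ab}}$ denotes the abelianization of a group $G$. -}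

module Defs where

open import Data.Nat as ℕ using (ℕ; zero; suc; _^_)
open import Data.Integer using (ℤ; +_; _+_; _-_; _*_; -_; ∣_∣)
open import Data.Integer.Divisibility using (_∣_)
open import Data.Integer.DivMod using (_/_)
open import Data.Fin using (Fin; zero; suc)
open import Data.Product using (_×_; _,_; Σ)
open import Data.Maybe using (Maybe; just; nothing)
import Data.Maybe
open import Data.Bool using (Bool; true; false; if_then_else_)
open import Relation.Binary.PropositionalEquality using (_≡_)
open import Relation.Nullary using (Dec; yes; no; _×-dec_)
open import Relation.Nullary.Decidable using (⌊_⌋)
import Data.Nat.Divisibility as ℕD
import Data.Integer.Properties as ℤP

record M2 : Set where
  constructor mat
  field
    a b c d : ℤ
open M2 public

_·_ : M2 → M2 → M2
mat a₁ b₁ c₁ d₁ · mat a₂ b₂ c₂ d₂ =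
  mat (a₁ * a₂ + b₁ * c₂) (a₁ * b₂ + b₁ * d₂) (c₁ * a₂ + d₁ * c₂) (c₁ * b₂ + d₁ * d₂)
infixl 7 _·_

I₂ : M2
I₂ = mat (+ 1) (+ 0) (+ 0) (+ 1)

det : M2 → ℤ
det (mat a b c d) = a * d - b * c

-- inverse of a determinant-one matrix
inv : M2 → M2
inv (mat a b c d) = mat d (- b) (- c) a

-- a "subgroup" of SL2(Z) given by a membership predicate
Pred : Set₁
Pred = M2 → Set

_∩_ : Pred → Pred → Pred
(P ∩ Q) g = P g × Q g

_≡_[mod_] : ℤ → ℤ → ℕ → Set
x ≡ y [mod m ] = (+ m) ∣ (x - y)

_≡?_[mod_] : ∀ x y m → Dec (x ≡ y [mod m ])
x ≡? y [mod m ] = m ℕD.∣? ∣ x - y ∣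

SL2 : Pred
SL2 g = det g ≡ + 1

Γ₁ : ℕ → Pred
Γ₁ M g = SL2 g × (a g ≡ + 1 [mod M ]) × (c g ≡ + 0 [mod M ]) × (d g ≡ + 1 [mod M ])

Γ₀ : ℕ → Pred
Γ₀ M g = SL2 g × (c g ≡ + 0 [mod M ])

Γ⁰2 : Pred
Γ⁰2 g = SL2 g × (b g ≡ + 0 [mod 2 ])

Φ : ℕ → ℕ → ℕ → Pred
Φ N r s = Γ₁ (2 ^ s ℕ.* N) ∩ Γ₀ (2 ^ r)

ΦΓ⁰2? : ∀ N r s g → Dec ((Φ N r s ∩ Γ⁰2) g)
ΦΓ⁰2? N r s g =
  (((det g ℤP.≟ + 1) ×-dec ((a g ≡? + 1 [mod 2 ^ s ℕ.* N ]) ×-dec ((c g ≡? + 0 [mod 2 ^ s ℕ.* N ]) ×-dec (d g ≡? + 1 [mod 2 ^ s ℕ.* N ]))))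
  ×-dec ((det g ℤP.≟ + 1) ×-dec (c g ≡? + 0 [mod 2 ^ r ])))
  ×-dec ((det g ℤP.≟ + 1) ×-dec (b g ≡? + 0 [mod 2 ]))

data Comm (P : Pred) : Pred where
  one  : Comm P I₂
  comm : ∀ {x y} → P x → P y → Comm P (x · y · inv x · inv y)
  mul  : ∀ {x y} → Comm P x → Comm P y → Comm P (x · y)
  inv' : ∀ {x} → Comm P x → Comm P (inv x)

-- equality in the abelianization P^ab of representatives g h ∈ P
AbEq : Pred → M2 → M2 → Set
AbEq P g h = Comm P (g · inv h)

IsLeftTransversal : Pred → Pred → (n : ℕ) → (Fin n → M2) → Set
IsLeftTransversal H K n x =
  ((i : Fin n) → H (x i)) ×
  ((h : M2) → H h → Σ (Fin n) (λ i → K (inv (x i) · h))) ×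
  ((h : M2) → H h → (i j : Fin n) → K (inv (x i) · h) → K (inv (x j) · h) → i ≡ j)

search : (n : ℕ) → (Fin n → Bool) → Maybe (Fin n)
search zero    p = nothing
search (suc n) p = if p zero then just zero else Data.Maybe.map suc (search n (λ i → p (suc i)))

-- transfer V : H^ab → K^ab (on representatives), w.r.t. the left transversal x:
-- g x_i = x_{σ(i)} k_i,  V(g) = ∏_i k_i
transferFactor : (K? : (g : M2) → Bool) → (n : ℕ) → (Fin n → M2) → M2 → Fin n → M2
transferFactor K? n x g i with search n (λ j → K? (inv (x j) · g · x i))
... | just j  = inv (x j) · g · x i
... | nothing = I₂

prodFin : (n : ℕ) → (Fin n → M2) → M2
prodFin zero    f = I₂
prodFin (suc n) f = f zero · prodFin n (λ i → f (suc i))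

transfer : (K? : (g : M2) → Bool) → (n : ℕ) → (Fin n → M2) → M2 → M2
transfer K? n x g = prodFin n (transferFactor K? n x g)

-- g ↦ t g t⁻¹ with t = diag(1,2): (a b; c d) ↦ (a, b/2; 2c, d)
conjT : M2 → M2
conjT (mat a b c d) = mat a (b / + 2) (+ 2 * c) d

-- U' : Φ_r^s ab → Φ_{r+1}^s ab, computed with the transversal x of Φ_r^s ∩ Γ⁰(2) in Φ_r^s
U′ : ℕ → ℕ → ℕ → (n : ℕ) → (Fin n → M2) → M2 → M2
U′ N r s n x g = conjT (transfer (λ h → ⌊ ΦΓ⁰2? N r s h ⌋) n x g)

{-# OPTIONS --safe #-}
-- For s ≥ 1 the diagonal entries of elements of Φ are odd, so b mod 2 is a homomorphism
-- Φ → ℤ/2 with kernel Φ ∩ Γ⁰(2); the cosets are represented by I₂ and T = (1 1; 0 1), and every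
-- transversal has exactly two elements, one of each parity. The transfer to this index-two
-- subgroup can then be computed by hand: modulo the commutators of any group K′ ⊇ Φ ∩ Γ⁰(2) it is
-- g · T⁻¹gT if b g is even and g² if b g is odd, whatever the transversal and the level (r, s).
-- Hence the transfers at levels (r, s) and (r′, s′) agree in (Φ_{r′}^{s′} ∩ Γ⁰(2))^ab, conjugation
-- by t = diag(1, 2) carries this into Φ_{r′+1}^{s′ ab}, and inclusion gives the second claim.
module Submission where

open import Defs
open import Data.Nat using (ℕ; suc; _≤_)
open import Data.Nat.Divisibility using (_∣_)
open import Data.Fin using (Fin; zero; suc)
open import Data.Product using (_×_; _,_; proj₁; proj₂; ∃; Σ)
open import Relation.Nullary using (¬_; Dec)
open import Relation.Nullary.Decidable using (⌊_⌋; isYes≗does; dec-true; dec-false)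
import Data.Nat as ℕ
import Data.Nat.Properties as ℕP
import Data.Nat.Divisibility as ℕD
open import Data.Integer using (ℤ; +_; _+_; _-_; _*_; -_)
import Data.Integer.Properties as ℤP
import Data.Integer.Divisibility.Signed as ℤS
open import Data.Integer.Tactic.RingSolver using (solve-∀)
open import Data.Bool using (Bool; true; false; not; _xor_)
open import Data.Bool.Properties using (xor-same; not-¬)
open import Data.Fin.Properties using (2↔Bool)
open import Data.Fin.Permutation using (↔⇒≡)
open import Function.Bundles using (mk⤖)
open import Function.Definitions using (Injective; StrictlySurjective)
open import Function.Consequences.Propositional using (strictlySurjective⇒surjective)
open import Function.Construct.Composition using (_↔-∘_)
open import Function.Construct.Symmetry using (↔-sym)
open import Function.Properties.Bijection using (⤖⇒↔)
open import Data.Empty using (⊥-elim)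
open import Data.Integer.DivMod using (_/_; _%_; a≡a%n+[a/n]*n; n%d<d)
open import Relation.Binary.PropositionalEquality

mat-≡ : ∀ {a b c d a′ b′ c′ d′} → a ≡ a′ → b ≡ b′ → c ≡ c′ → d ≡ d′ →
        mat a b c d ≡ mat a′ b′ c′ d′
mat-≡ refl refl refl refl = refl

·-assoc : ∀ A B C → (A · B) · C ≡ A · (B · C)
·-assoc (mat a b c d) (mat e f g h) (mat i j k l) =
  mat-≡ (entry a b e f g h i k) (entry a b e f g h j l) (entry c d e f g h i k) (entry c d e f g h j l)
  where
  entry : ∀ a b e f g h i k →
          (a * e + b * g) * i + (a * f + b * h) * k ≡ a * (e * i + f * k) + b * (g * i + h * k)
  entry = solve-∀

·-identityˡ : ∀ A → I₂ · A ≡ A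
·-identityˡ (mat a b c d) = mat-≡ (entry a c) (entry b d) (entry′ a c) (entry′ b d)
  where
  entry : ∀ x y → + 1 * x + + 0 * y ≡ x
  entry = solve-∀
  entry′ : ∀ x y → + 0 * x + + 1 * y ≡ y
  entry′ = solve-∀

·-identityʳ : ∀ A → A · I₂ ≡ A
·-identityʳ (mat a b c d) = mat-≡ (entry a b) (entry′ a b) (entry c d) (entry′ c d)
  where
  entry : ∀ x y → x * + 1 + y * + 0 ≡ x
  entry = solve-∀
  entry′ : ∀ x y → x * + 0 + y * + 1 ≡ y
  entry′ = solve-∀

det-inv : ∀ A → det (inv A) ≡ det A
det-inv (mat a b c d) = entry a b c d
  where
  entry : ∀ a b c d → d * a - (- b) * (- c) ≡ a * d - b * c
  entry = solve-∀

det-· : ∀ A B → det (A · B) ≡ det A * det B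
det-· (mat a b c d) (mat e f g h) = entry a b c d e f g h
  where
  entry : ∀ a b c d e f g h →
          (a * e + b * g) * (c * f + d * h) - (a * f + b * h) * (c * e + d * g) ≡ (a * d - b * c) * (e * h - f * g)
  entry = solve-∀

inv-· : ∀ A B → inv (A · B) ≡ inv B · inv A
inv-· (mat a b c d) (mat e f g h) = mat-≡ (entry₁ c d f h) (entry₂ a b f h) (entry₃ c d e g) (entry₄ a b e g)
  where
  entry₁ : ∀ x y z w → x * z + y * w ≡ w * y + (- z) * (- x)
  entry₁ = solve-∀
  entry₂ : ∀ x y z w → - (x * z + y * w) ≡ w * (- y) + (- z) * x
  entry₂ = solve-∀
  entry₃ : ∀ x y z w → - (x * z + y * w) ≡ (- w) * y + z * (- x)
  entry₃ = solve-∀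
  entry₄ : ∀ x y z w → x * z + y * w ≡ (- w) * (- y) + z * x
  entry₄ = solve-∀

·-inverseʳ : ∀ A → SL2 A → A · inv A ≡ I₂
·-inverseʳ (mat a b c d) det≡1 =
  mat-≡ (trans (entry₁ a b c d) det≡1) (entry₂ a b) (entry₃ c d) (trans (entry₄ a b c d) det≡1)
  where
  entry₁ : ∀ a b c d → a * d + b * (- c) ≡ a * d - b * c
  entry₁ = solve-∀
  entry₂ : ∀ a b → a * (- b) + b * a ≡ + 0
  entry₂ = solve-∀
  entry₃ : ∀ c d → c * d + d * (- c) ≡ + 0
  entry₃ = solve-∀
  entry₄ : ∀ a b c d → c * (- b) + d * a ≡ a * d - b * c
  entry₄ = solve-∀

inv-involutive : ∀ A → inv (inv A) ≡ A
inv-involutive (mat a b c d) = mat-≡ refl (ℤP.neg-involutive b) (ℤP.neg-involutive c) refl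

·-inverseˡ : ∀ A → SL2 A → inv A · A ≡ I₂
·-inverseˡ A det≡1 =
  subst (λ B → inv A · B ≡ I₂) (inv-involutive A) (·-inverseʳ (inv A) (trans (det-inv A) det≡1))

·-cancelʳ : ∀ A x → SL2 x → A · x · inv x ≡ A
·-cancelʳ A x det≡1 =
  trans (·-assoc A x (inv x)) (trans (cong (A ·_) (·-inverseʳ x det≡1)) (·-identityʳ A))

·-cancelʳ′ : ∀ A x → SL2 x → A · inv x · x ≡ A
·-cancelʳ′ A x det≡1 =
  trans (·-assoc A (inv x) x) (trans (cong (A ·_) (·-inverseˡ x det≡1)) (·-identityʳ A))

·-cancelˡ : ∀ y x → SL2 y → y · (inv y · x) ≡ x
·-cancelˡ y x det≡1 =
  trans (sym (·-assoc y (inv y) x)) (trans (cong (_· x) (·-inverseʳ y det≡1)) (·-identityˡ x))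

·-cancelˡ′ : ∀ y x → SL2 y → inv y · (y · x) ≡ x
·-cancelˡ′ y x det≡1 =
  trans (sym (·-assoc (inv y) y x)) (trans (cong (_· x) (·-inverseˡ y det≡1)) (·-identityˡ x))

conj-· : ∀ y w m → inv (y · w) · m · (y · w) ≡ inv w · (inv y · m · y) · w
conj-· y w m = begin
  inv (y · w) · m · (y · w)       ≡⟨ cong (λ v → v · m · (y · w)) (inv-· y w) ⟩
  inv w · inv y · m · (y · w)     ≡⟨ sym (·-assoc (inv w · inv y · m) y w) ⟩
  inv w · inv y · m · y · w       ≡⟨ cong (λ v → v · y · w) (·-assoc (inv w) (inv y) m) ⟩
  inv w · (inv y · m) · y · w     ≡⟨ cong (_· w) (·-assoc (inv w) (inv y · m) y) ⟩
  inv w · (inv y · m · y) · w     ∎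
  where open ≡-Reasoning

-- `x ≡ y [mod m ]` unfolds to a divisibility of `∣ x - y ∣`, from which Agda cannot
-- recover x and y; the wrapper keeps them visible to unification.
record _≡_⟨mod_⟩ (x y : ℤ) (m : ℕ) : Set where
  constructor wrap
  field unwrap : x ≡ y [mod m ]
open _≡_⟨mod_⟩ public

infix 4 _≡_⟨mod_⟩

module _ {m : ℕ} where

  private
    ∣-difference : ∀ {x y} → x ≡ y ⟨mod m ⟩ → (+ m) ℤS.∣ (x - y)
    ∣-difference x≡y = ℤS.∣ᵤ⇒∣ (unwrap x≡y)

    from-∣ : ∀ {x y d} → d ≡ x - y → (+ m) ℤS.∣ d → x ≡ y ⟨mod m ⟩
    from-∣ d≡x-y m∣d = wrap (ℤS.∣⇒∣ᵤ (subst ((+ m) ℤS.∣_) d≡x-y m∣d))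

  mod-refl : ∀ {x} → x ≡ x ⟨mod m ⟩
  mod-refl {x} = from-∣ (sym (ℤP.+-inverseʳ x)) (ℤS.divides (+ 0) refl)

  mod-sym : ∀ {x y} → x ≡ y ⟨mod m ⟩ → y ≡ x ⟨mod m ⟩
  mod-sym {x} {y} x≡y = from-∣ (swap x y) (ℤS.∣m⇒∣-m (∣-difference x≡y))
    where
    swap : ∀ x y → - (x - y) ≡ y - x
    swap = solve-∀

  mod-trans : ∀ {x y z} → x ≡ y ⟨mod m ⟩ → y ≡ z ⟨mod m ⟩ → x ≡ z ⟨mod m ⟩
  mod-trans {x} {y} {z} x≡y y≡z =
    from-∣ (telescope x y z) (ℤS.∣m∣n⇒∣m+n (∣-difference x≡y) (∣-difference y≡z))
    where
    telescope : ∀ x y z → (x - y) + (y - z) ≡ x - z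
    telescope = solve-∀

  mod-+ : ∀ {x x′ y y′} → x ≡ x′ ⟨mod m ⟩ → y ≡ y′ ⟨mod m ⟩ → x + y ≡ x′ + y′ ⟨mod m ⟩
  mod-+ {x} {x′} {y} {y′} x≡x′ y≡y′ =
    from-∣ (split x x′ y y′) (ℤS.∣m∣n⇒∣m+n (∣-difference x≡x′) (∣-difference y≡y′))
    where
    split : ∀ x x′ y y′ → (x - x′) + (y - y′) ≡ (x + y) - (x′ + y′)
    split = solve-∀

  mod-* : ∀ {x x′ y y′} → x ≡ x′ ⟨mod m ⟩ → y ≡ y′ ⟨mod m ⟩ → x * y ≡ x′ * y′ ⟨mod m ⟩
  mod-* {x} {x′} {y} {y′} x≡x′ y≡y′ =
    from-∣ (split x x′ y y′)
           (ℤS.∣m∣n⇒∣m+n (ℤS.∣n⇒∣m*n x (∣-difference y≡y′)) (ℤS.∣m⇒∣m*n y′ (∣-difference x≡x′)))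
    where
    split : ∀ x x′ y y′ → x * (y - y′) + (x - x′) * y′ ≡ x * y - x′ * y′
    split = solve-∀

  mod-neg : ∀ {x y} → x ≡ y ⟨mod m ⟩ → - x ≡ - y ⟨mod m ⟩
  mod-neg {x} {y} x≡y = from-∣ (negate x y) (ℤS.∣m⇒∣-m (∣-difference x≡y))
    where
    negate : ∀ x y → - (x - y) ≡ - x - - y
    negate = solve-∀

  mod-≡ : ∀ {x y z} → x ≡ y ⟨mod m ⟩ → y ≡ z → x ≡ z ⟨mod m ⟩
  mod-≡ x≡y refl = x≡y

  multiple≡0 : ∀ q → q * + m ≡ + 0 ⟨mod m ⟩
  multiple≡0 q = from-∣ (sym (ℤP.+-identityʳ (q * + m))) (ℤS.divides q refl)

  ≡0⇒multiple : ∀ {x} → x ≡ + 0 ⟨mod m ⟩ → ∃ λ q → x ≡ q * + m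
  ≡0⇒multiple {x} x≡0 with ∣-difference x≡0
  ... | ℤS.divides q x-0≡qm = q , trans (sym (ℤP.+-identityʳ x)) x-0≡qm

scale-≡0 : ∀ {m} k {x} → x ≡ + 0 ⟨mod m ⟩ → + k * x ≡ + 0 ⟨mod k ℕ.* m ⟩
scale-≡0 {m} k x≡0 with ≡0⇒multiple x≡0
... | q , refl = subst (_≡ + 0 ⟨mod k ℕ.* m ⟩) (trans (cong (q *_) (ℤP.pos-* k m)) (regroup q (+ k) (+ m)))
                       (multiple≡0 q)
  where
  regroup : ∀ q k m → q * (k * m) ≡ k * (q * m)
  regroup = solve-∀

mod-∣ : ∀ {m m′ x y} → m′ ℕD.∣ m → x ≡ y ⟨mod m ⟩ → x ≡ y ⟨mod m′ ⟩
mod-∣ m′∣m (wrap x≡y) = wrap (ℕD.∣-trans m′∣m x≡y)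

≡[mod]-refl : ∀ {m} x → x ≡ x [mod m ]
≡[mod]-refl x = unwrap (mod-refl {x = x})

≡0[mod]-neg : ∀ {m} x → x ≡ + 0 [mod m ] → (- x) ≡ + 0 [mod m ]
≡0[mod]-neg x x≡0 = unwrap (mod-neg {x = x} {+ 0} (wrap x≡0))

record IsSubgroup (P : Pred) : Set where
  field
    ⊆SL2       : ∀ {g} → P g → SL2 g
    ∋I₂        : P I₂
    ·-closed   : ∀ {g h} → P g → P h → P (g · h)
    inv-closed : ∀ {g} → P g → P (inv g)

SL2-· : ∀ {A B} → SL2 A → SL2 B → SL2 (A · B)
SL2-· {A} {B} detA≡1 detB≡1 = trans (det-· A B) (cong₂ _*_ detA≡1 detB≡1)

SL2-inv : ∀ {A} → SL2 A → SL2 (inv A)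
SL2-inv {A} det≡1 = trans (det-inv A) det≡1

module _ {m : ℕ} where

  ·-a≡1 : ∀ {A B} → a A ≡ + 1 ⟨mod m ⟩ → c B ≡ + 0 ⟨mod m ⟩ → a B ≡ + 1 ⟨mod m ⟩ →
          a (A · B) ≡ + 1 ⟨mod m ⟩
  ·-a≡1 {mat a₁ b₁ c₁ d₁} {mat a₂ b₂ c₂ d₂} a₁≡1 c₂≡0 a₂≡1 =
    mod-≡ (mod-+ (mod-* a₁≡1 a₂≡1) (mod-* (mod-refl {x = b₁}) c₂≡0)) (cong (_+_ (+ 1)) (ℤP.*-zeroʳ b₁))

  ·-d≡1 : ∀ {A B} → c A ≡ + 0 ⟨mod m ⟩ → d A ≡ + 1 ⟨mod m ⟩ → d B ≡ + 1 ⟨mod m ⟩ →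
          d (A · B) ≡ + 1 ⟨mod m ⟩
  ·-d≡1 {mat a₁ b₁ c₁ d₁} {mat a₂ b₂ c₂ d₂} c₁≡0 d₁≡1 d₂≡1 =
    mod-+ (mod-* c₁≡0 (mod-refl {x = b₂})) (mod-* d₁≡1 d₂≡1)

  ·-c≡0 : ∀ {A B} → c A ≡ + 0 ⟨mod m ⟩ → c B ≡ + 0 ⟨mod m ⟩ → c (A · B) ≡ + 0 ⟨mod m ⟩
  ·-c≡0 {mat a₁ b₁ c₁ d₁} {mat a₂ b₂ c₂ d₂} c₁≡0 c₂≡0 =
    mod-≡ (mod-+ (mod-* c₁≡0 (mod-refl {x = a₂})) (mod-* (mod-refl {x = d₁}) c₂≡0))
          (trans (ℤP.+-identityˡ _) (ℤP.*-zeroʳ d₁))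

  ·-b≡0 : ∀ {A B} → b A ≡ + 0 ⟨mod m ⟩ → b B ≡ + 0 ⟨mod m ⟩ → b (A · B) ≡ + 0 ⟨mod m ⟩
  ·-b≡0 {mat a₁ b₁ c₁ d₁} {mat a₂ b₂ c₂ d₂} b₁≡0 b₂≡0 =
    mod-≡ (mod-+ (mod-* (mod-refl {x = a₁}) b₂≡0) (mod-* b₁≡0 (mod-refl {x = d₂})))
          (cong (_+ + 0) (ℤP.*-zeroʳ a₁))

Γ₁-subgroup : ∀ M → IsSubgroup (Γ₁ M)
Γ₁-subgroup M = record
  { ⊆SL2       = proj₁
  ; ∋I₂        = refl , ≡[mod]-refl (+ 1) , ≡[mod]-refl (+ 0) , ≡[mod]-refl (+ 1)
  ; ·-closed   = λ {g} {h} (det₁ , a₁ , c₁ , d₁) (det₂ , a₂ , c₂ , d₂) →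
                   SL2-· {g} {h} det₁ det₂ ,
                   unwrap (·-a≡1 {A = g} {h} (wrap a₁) (wrap c₂) (wrap a₂)) ,
                   unwrap (·-c≡0 {A = g} {h} (wrap c₁) (wrap c₂)) ,
                   unwrap (·-d≡1 {A = g} {h} (wrap c₁) (wrap d₁) (wrap d₂))
  ; inv-closed = λ {g} (det≡1 , a≡1 , c≡0 , d≡1) → SL2-inv {g} det≡1 , d≡1 , ≡0[mod]-neg (c g) c≡0 , a≡1
  }

Γ₀-subgroup : ∀ L → IsSubgroup (Γ₀ L)
Γ₀-subgroup L = record
  { ⊆SL2       = proj₁
  ; ∋I₂        = refl , ≡[mod]-refl (+ 0)
  ; ·-closed   = λ {g} {h} (det₁ , c₁) (det₂ , c₂) →
                   SL2-· {g} {h} det₁ det₂ , unwrap (·-c≡0 {A = g} {h} (wrap c₁) (wrap c₂))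
  ; inv-closed = λ {g} (det≡1 , c≡0) → SL2-inv {g} det≡1 , ≡0[mod]-neg (c g) c≡0
  }

Γ⁰2-subgroup : IsSubgroup Γ⁰2
Γ⁰2-subgroup = record
  { ⊆SL2       = proj₁
  ; ∋I₂        = refl , ≡[mod]-refl (+ 0)
  ; ·-closed   = λ {g} {h} (det₁ , b₁) (det₂ , b₂) →
                   SL2-· {g} {h} det₁ det₂ , unwrap (·-b≡0 {A = g} {h} (wrap b₁) (wrap b₂))
  ; inv-closed = λ {g} (det≡1 , b≡0) → SL2-inv {g} det≡1 , ≡0[mod]-neg (b g) b≡0
  }

∩-subgroup : ∀ {P Q} → IsSubgroup P → IsSubgroup Q → IsSubgroup (P ∩ Q)
∩-subgroup P-sub Q-sub = record
  { ⊆SL2       = λ (p , _) → P.⊆SL2 p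
  ; ∋I₂        = P.∋I₂ , Q.∋I₂
  ; ·-closed   = λ (p₁ , q₁) (p₂ , q₂) → P.·-closed p₁ p₂ , Q.·-closed q₁ q₂
  ; inv-closed = λ (p , q) → P.inv-closed p , Q.inv-closed q
  }
  where
  module P = IsSubgroup P-sub
  module Q = IsSubgroup Q-sub

Φ-subgroup : ∀ N r s → IsSubgroup (Φ N r s)
Φ-subgroup N r s = ∩-subgroup (Γ₁-subgroup (2 ℕ.^ s ℕ.* N)) (Γ₀-subgroup (2 ℕ.^ r))

^-monoʳ-∣ : ∀ m {r R} → r ≤ R → m ℕ.^ r ∣ m ℕ.^ R
^-monoʳ-∣ m {R = R} ℕ.z≤n = ℕD.1∣ (m ℕ.^ R)
^-monoʳ-∣ m (ℕ.s≤s r≤R)   = ℕD.*-monoʳ-∣ m (^-monoʳ-∣ m r≤R)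

Φ-mono : ∀ {N r s R S} → r ≤ R → s ≤ S → ∀ {g} → Φ N R S g → Φ N r s g
Φ-mono {N} {r} {s} {R} {S} r≤R s≤S ((det≡1 , a≡1 , c≡0 , d≡1) , (_ , c≡0′)) =
  (det≡1 , ℕD.∣-trans level a≡1 , ℕD.∣-trans level c≡0 , ℕD.∣-trans level d≡1) ,
  (det≡1 , ℕD.∣-trans (^-monoʳ-∣ 2 r≤R) c≡0′)
  where
  level : 2 ℕ.^ s ℕ.* N ∣ 2 ℕ.^ S ℕ.* N
  level = ℕD.*-monoˡ-∣ N (^-monoʳ-∣ 2 s≤S)

Φ-odd-diagonal : ∀ {N r s} → 1 ≤ s → ∀ {g} → Φ N r s g → a g ≡ + 1 ⟨mod 2 ⟩ × d g ≡ + 1 ⟨mod 2 ⟩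
Φ-odd-diagonal {N} {s = suc s} _ ((_ , a≡1 , _ , d≡1) , _) = mod-∣ 2∣level (wrap a≡1) , mod-∣ 2∣level (wrap d≡1)
  where
  2∣level : 2 ∣ 2 ℕ.^ suc s ℕ.* N
  2∣level = ℕD.∣-trans (ℕD.m∣m*n (2 ℕ.^ s)) (ℕD.m∣m*n N)

T : M2
T = mat (+ 1) (+ 1) (+ 0) (+ 1)

T∈Φ : ∀ {N r s} → Φ N r s T
T∈Φ = (refl , ≡[mod]-refl (+ 1) , ≡[mod]-refl (+ 0) , ≡[mod]-refl (+ 1)) , (refl , ≡[mod]-refl (+ 0))

Comm-mono : ∀ {P Q} → (∀ {g} → P g → Q g) → ∀ {g} → Comm P g → Comm Q g
Comm-mono P⊆Q one            = one
Comm-mono P⊆Q (comm px py)   = comm (P⊆Q px) (P⊆Q py)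
Comm-mono P⊆Q (mul c₁ c₂)    = mul (Comm-mono P⊆Q c₁) (Comm-mono P⊆Q c₂)
Comm-mono P⊆Q (inv' c)       = inv' (Comm-mono P⊆Q c)

module Abelianization {P : Pred} (P-sub : IsSubgroup P) where
  open IsSubgroup P-sub

  Comm⊆ : ∀ {g} → Comm P g → P g
  Comm⊆ one          = ∋I₂
  Comm⊆ (comm px py) = ·-closed (·-closed (·-closed px py) (inv-closed px)) (inv-closed py)
  Comm⊆ (mul c₁ c₂)  = ·-closed (Comm⊆ c₁) (Comm⊆ c₂)
  Comm⊆ (inv' c)     = inv-closed (Comm⊆ c)

  AbEq-sym : ∀ {g h} → AbEq P g h → AbEq P h g
  AbEq-sym {g} {h} g≈h =
    subst (Comm P) (trans (inv-· g (inv h)) (cong (_· inv g) (inv-involutive h))) (inv' g≈h)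

  AbEq-trans : ∀ {g h k} → P h → AbEq P g h → AbEq P h k → AbEq P g k
  AbEq-trans {g} {h} {k} ph g≈h h≈k =
    subst (Comm P) (trans (sym (·-assoc (g · inv h) h (inv k))) (cong (_· inv k) (·-cancelʳ′ g h (⊆SL2 ph))))
      (mul g≈h h≈k)

  AbEq-closed : ∀ {g h} → AbEq P g h → P h → P g
  AbEq-closed {g} {h} g≈h ph = subst P (·-cancelʳ′ g h (⊆SL2 ph)) (·-closed (Comm⊆ g≈h) ph)

  AbEq-comm : ∀ {g h} → P g → P h → AbEq P (g · h) (h · g)
  AbEq-comm {g} {h} pg ph =
    subst (Comm P) (trans (·-assoc (g · h) (inv g) (inv h)) (cong (g · h ·_) (sym (inv-· h g)))) (comm pg ph)

  AbEq-conj : ∀ {x g} → P x → P g → AbEq P (inv x · g · x) g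
  AbEq-conj {x} {g} px pg =
    subst (Comm P) (cong (λ y → inv x · g · y · inv g) (inv-involutive x)) (comm (inv-closed px) pg)

  AbEq-conj-coset : ∀ {x y m} → SL2 y → P (inv y · x) → P (inv y · m · y) →
                    AbEq P (inv x · m · x) (inv y · m · y)
  AbEq-conj-coset {x} {y} {m} det≡1 pw pm′ =
    subst (λ v → AbEq P (inv v · m · v) (inv y · m · y)) (·-cancelˡ y x det≡1)
      (subst (λ v → AbEq P v (inv y · m · y)) (sym (conj-· y (inv y · x) m)) (AbEq-conj pw pm′))

  Comm-normal : ∀ {x g} → P x → Comm P g → Comm P (x · g · inv x)
  Comm-normal {x} {g} px cg =
    subst (Comm P) (·-cancelʳ′ (x · g · inv x) g (⊆SL2 (Comm⊆ cg))) (mul (comm px (Comm⊆ cg)) cg)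

  AbEq-· : ∀ {g g′ h h′} → P g → AbEq P g g′ → AbEq P h h′ → AbEq P (g · h) (g′ · h′)
  AbEq-· {g} {g′} {h} {h′} pg g≈g′ h≈h′ = subst (Comm P) regroup (mul (Comm-normal pg h≈h′) g≈g′)
    where
    open ≡-Reasoning
    regroup : g · (h · inv h′) · inv g · (g · inv g′) ≡ g · h · inv (g′ · h′)
    regroup = begin
      g · (h · inv h′) · inv g · (g · inv g′) ≡⟨ ·-assoc (g · (h · inv h′)) (inv g) (g · inv g′) ⟩
      g · (h · inv h′) · (inv g · (g · inv g′)) ≡⟨ cong (g · (h · inv h′) ·_) (·-cancelˡ′ g (inv g′) (⊆SL2 pg)) ⟩
      g · (h · inv h′) · inv g′               ≡⟨ cong (_· inv g′) (sym (·-assoc g h (inv h′))) ⟩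
      g · h · inv h′ · inv g′                 ≡⟨ ·-assoc (g · h) (inv h′) (inv g′) ⟩
      g · h · (inv h′ · inv g′)               ≡⟨ cong (g · h ·_) (sym (inv-· g′ h′)) ⟩
      g · h · inv (g′ · h′)                   ∎

bit : Bool → ℤ
bit false = + 0
bit true  = + 1

record Parity (z : ℤ) (odd : Bool) : Set where
  constructor parity
  field ≡bit : z ≡ bit odd ⟨mod 2 ⟩

1≢0⟨mod2⟩ : ¬ (+ 1 ≡ + 0 ⟨mod 2 ⟩)
1≢0⟨mod2⟩ (wrap 2∣1) with ℕD.∣1⇒≡1 2∣1
... | ()

parity-unique : ∀ {z p q} → Parity z p → Parity z q → p ≡ q
parity-unique {p = false} {false} _ _ = refl
parity-unique {p = true}  {true}  _ _ = refl
parity-unique {p = false} {true}  (parity z≡0) (parity z≡1) = ⊥-elim (1≢0⟨mod2⟩ (mod-trans (mod-sym z≡1) z≡0))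
parity-unique {p = true}  {false} (parity z≡1) (parity z≡0) = ⊥-elim (1≢0⟨mod2⟩ (mod-trans (mod-sym z≡1) z≡0))

parityOf : ∀ z → Σ Bool (Parity z)
parityOf z = remainder-parity (z % + 2) (n%d<d z (+ 2))
  (subst (_≡ + (z % + 2) ⟨mod 2 ⟩) (sym (a≡a%n+[a/n]*n z (+ 2))) z≡remainder)
  where
  z≡remainder : + (z % + 2) + (z / + 2) * + 2 ≡ + (z % + 2) ⟨mod 2 ⟩
  z≡remainder = mod-≡ (mod-+ (mod-refl {x = + (z % + 2)}) (multiple≡0 (z / + 2))) (ℤP.+-identityʳ _)
  remainder-parity : ∀ r → r ℕ.< 2 → z ≡ + r ⟨mod 2 ⟩ → Σ Bool (Parity z)
  remainder-parity 0 _ z≡0 = false , parity z≡0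
  remainder-parity 1 _ z≡1 = true , parity z≡1
  remainder-parity (suc (suc _)) (ℕ.s≤s (ℕ.s≤s ())) _

b-parity-· : ∀ {x y p q} → a x ≡ + 1 ⟨mod 2 ⟩ → d y ≡ + 1 ⟨mod 2 ⟩ →
             Parity (b x) p → Parity (b y) q → Parity (b (x · y)) (p xor q)
b-parity-· {p = p} {q} ax≡1 dy≡1 (parity bx≡p) (parity by≡q) =
  parity (mod-trans (mod-+ (mod-* ax≡1 by≡q) (mod-* bx≡p dy≡1)) (bit-xor p q))
  where
  bit-xor : ∀ p q → + 1 * bit q + bit p * + 1 ≡ bit (p xor q) ⟨mod 2 ⟩
  bit-xor false false = mod-refl
  bit-xor false true  = mod-refl
  bit-xor true  false = mod-refl
  bit-xor true  true  = multiple≡0 (+ 1)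

b-parity-inv : ∀ {x p} → Parity (b x) p → Parity (b (inv x)) p
b-parity-inv {p = p} (parity bx≡p) = parity (mod-trans (mod-neg bx≡p) (neg-bit p))
  where
  neg-bit : ∀ p → - bit p ≡ bit p ⟨mod 2 ⟩
  neg-bit false = mod-refl
  neg-bit true  = wrap ℕD.∣-refl

[q*2]/2≡q : ∀ q → (q * + 2) / + 2 ≡ q
[q*2]/2≡q q = halve (q * + 2 % + 2) (q * + 2 / + 2) (n%d<d (q * + 2) (+ 2)) (a≡a%n+[a/n]*n (q * + 2) (+ 2))
  where
  halve : ∀ r t → r ℕ.< 2 → q * + 2 ≡ + r + t * + 2 → t ≡ q
  halve 0 t _ q2≡t2 = ℤP.*-cancelʳ-≡ t q (+ 2) (sym (trans q2≡t2 (ℤP.+-identityˡ (t * + 2))))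
  halve 1 t _ q2≡1+t2 = ⊥-elim (1≢0⟨mod2⟩ (mod-trans (mod-sym q2≡1) (multiple≡0 q)))
    where
    q2≡1 : q * + 2 ≡ + 1 ⟨mod 2 ⟩
    q2≡1 = subst (_≡ + 1 ⟨mod 2 ⟩) (sym q2≡1+t2)
                 (mod-≡ (mod-+ (mod-refl {x = + 1}) (multiple≡0 t)) (ℤP.+-identityʳ (+ 1)))
  halve (suc (suc _)) _ (ℕ.s≤s (ℕ.s≤s ())) _

conjT-mat : ∀ a {b} c d q → b ≡ q * + 2 → conjT (mat a b c d) ≡ mat a q (+ 2 * c) d
conjT-mat a c d q refl = cong (λ b → mat a b (+ 2 * c) d) ([q*2]/2≡q q)

conjT-· : ∀ {A B} → b A ≡ + 0 ⟨mod 2 ⟩ → b B ≡ + 0 ⟨mod 2 ⟩ → conjT (A · B) ≡ conjT A · conjT B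
conjT-· {mat a₁ b₁ c₁ d₁} {mat a₂ b₂ c₂ d₂} b₁≡0 b₂≡0 with ≡0⇒multiple b₁≡0 | ≡0⇒multiple b₂≡0
... | q₁ , refl | q₂ , refl = begin
  conjT (mat a₁ (q₁ * + 2) c₁ d₁ · mat a₂ (q₂ * + 2) c₂ d₂)
    ≡⟨ conjT-mat _ _ _ (a₁ * q₂ + q₁ * d₂) (entry₂ a₁ q₂ q₁ d₂) ⟩
  mat (a₁ * a₂ + q₁ * + 2 * c₂) (a₁ * q₂ + q₁ * d₂) (+ 2 * (c₁ * a₂ + d₁ * c₂)) (c₁ * (q₂ * + 2) + d₁ * d₂)
    ≡⟨ mat-≡ (entry₁ a₁ a₂ q₁ c₂) refl (entry₃ c₁ a₂ d₁ c₂) (entry₄ c₁ q₂ d₁ d₂) ⟩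
  mat a₁ q₁ (+ 2 * c₁) d₁ · mat a₂ q₂ (+ 2 * c₂) d₂
    ≡⟨ sym (cong₂ _·_ (conjT-mat a₁ c₁ d₁ q₁ refl) (conjT-mat a₂ c₂ d₂ q₂ refl)) ⟩
  conjT (mat a₁ (q₁ * + 2) c₁ d₁) · conjT (mat a₂ (q₂ * + 2) c₂ d₂) ∎
  where
  open ≡-Reasoning
  entry₁ : ∀ a₁ a₂ q₁ c₂ → a₁ * a₂ + q₁ * + 2 * c₂ ≡ a₁ * a₂ + q₁ * (+ 2 * c₂)
  entry₁ = solve-∀
  entry₂ : ∀ a₁ q₂ q₁ d₂ → a₁ * (q₂ * + 2) + q₁ * + 2 * d₂ ≡ (a₁ * q₂ + q₁ * d₂) * + 2
  entry₂ = solve-∀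
  entry₃ : ∀ c₁ a₂ d₁ c₂ → + 2 * (c₁ * a₂ + d₁ * c₂) ≡ + 2 * c₁ * a₂ + d₁ * (+ 2 * c₂)
  entry₃ = solve-∀
  entry₄ : ∀ c₁ q₂ d₁ d₂ → c₁ * (q₂ * + 2) + d₁ * d₂ ≡ + 2 * c₁ * q₂ + d₁ * d₂
  entry₄ = solve-∀

conjT-inv : ∀ {A} → b A ≡ + 0 ⟨mod 2 ⟩ → conjT (inv A) ≡ inv (conjT A)
conjT-inv {mat a₁ b₁ c₁ d₁} b₁≡0 with ≡0⇒multiple b₁≡0
... | q , refl = begin
  conjT (mat d₁ (- (q * + 2)) (- c₁) a₁) ≡⟨ conjT-mat d₁ (- c₁) a₁ (- q) (ℤP.neg-distribˡ-* q (+ 2)) ⟩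
  mat d₁ (- q) (+ 2 * - c₁) a₁           ≡⟨ cong (λ c → mat d₁ (- q) c a₁) (sym (ℤP.neg-distribʳ-* (+ 2) c₁)) ⟩
  inv (mat a₁ q (+ 2 * c₁) d₁)           ≡⟨ cong inv (sym (conjT-mat a₁ c₁ d₁ q refl)) ⟩
  inv (conjT (mat a₁ (q * + 2) c₁ d₁))   ∎
  where open ≡-Reasoning

conjT-I₂ : conjT I₂ ≡ I₂
conjT-I₂ = refl

conjT-Φ : ∀ {N r s g} → (Φ N r s ∩ Γ⁰2) g → Φ N (suc r) s (conjT g)
conjT-Φ {N} {r} {s} {mat a₁ b₁ c₁ d₁} (((det≡1 , a≡1 , c≡0 , d≡1) , (_ , c≡0′)) , (_ , b≡0))
  with ≡0⇒multiple (wrap {x = b₁} {+ 0} b≡0)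
... | q , refl = subst (Φ N (suc r) s) (sym (conjT-mat a₁ c₁ d₁ q refl))
  ((det′ , a≡1 , unwrap 2c≡0 , d≡1) , (det′ , unwrap (scale-≡0 2 (wrap {x = c₁} {+ 0} c≡0′))))
  where
  2c≡0 : + 2 * c₁ ≡ + 0 ⟨mod 2 ℕ.^ s ℕ.* N ⟩
  2c≡0 = mod-* (mod-refl {x = + 2}) (wrap {x = c₁} {+ 0} c≡0)
  det′ : a₁ * d₁ - q * (+ 2 * c₁) ≡ + 1
  det′ = trans (regroup a₁ d₁ q c₁) det≡1
    where
    regroup : ∀ a d q c → a * d - q * (+ 2 * c) ≡ a * d - q * + 2 * c
    regroup = solve-∀

module _ {P Q : Pred} (P-sub : IsSubgroup P) (f : M2 → M2)
         (f-I₂ : f I₂ ≡ I₂)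
         (f-· : ∀ {g h} → P g → P h → f (g · h) ≡ f g · f h)
         (f-inv : ∀ {g} → P g → f (inv g) ≡ inv (f g))
         (f-maps : ∀ {g} → P g → Q (f g)) where
  open IsSubgroup P-sub
  open Abelianization P-sub using (Comm⊆)

  Comm-map : ∀ {g} → Comm P g → Comm Q (f g)
  Comm-map one = subst (Comm Q) (sym f-I₂) one
  Comm-map (comm {x} {y} px py) = subst (Comm Q) (sym f-commutator) (comm (f-maps px) (f-maps py))
    where
    pxy : P (x · y)
    pxy = ·-closed px py
    f-commutator : f (x · y · inv x · inv y) ≡ f x · f y · inv (f x) · inv (f y)
    f-commutator = trans (f-· (·-closed pxy (inv-closed px)) (inv-closed py))
                     (cong₂ _·_ (trans (f-· pxy (inv-closed px)) (cong₂ _·_ (f-· px py) (f-inv px)))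
                                (f-inv py))
  Comm-map (mul c₁ c₂) =
    subst (Comm Q) (sym (f-· (Comm⊆ c₁) (Comm⊆ c₂))) (mul (Comm-map c₁) (Comm-map c₂))
  Comm-map (inv' c)    = subst (Comm Q) (sym (f-inv (Comm⊆ c))) (inv' (Comm-map c))

  AbEq-map : ∀ {g h} → P g → P h → AbEq P g h → AbEq Q (f g) (f h)
  AbEq-map {g} pg ph g≈h =
    subst (Comm Q) (trans (f-· pg (inv-closed ph)) (cong (f g ·_) (f-inv ph))) (Comm-map g≈h)

AbEq-conjT : ∀ {N r s g h} → (Φ N r s ∩ Γ⁰2) g → (Φ N r s ∩ Γ⁰2) h →
             AbEq (Φ N r s ∩ Γ⁰2) g h → AbEq (Φ N (suc r) s) (conjT g) (conjT h)
AbEq-conjT {N} {r} {s} {g} {h} = AbEq-map (∩-subgroup (Φ-subgroup N r s) Γ⁰2-subgroup) conjT conjT-I₂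
  (λ {g} {h} (_ , _ , b≡0) (_ , _ , b′≡0) → conjT-· {g} {h} (wrap b≡0) (wrap b′≡0))
  (λ {g} (_ , _ , b≡0) → conjT-inv {g} (wrap b≡0))
  (λ {g} → conjT-Φ {N} {r} {s} {g}) {g} {h}

module _ (K? : M2 → Bool) (z : Fin 2 → M2) (g : M2) where
  private
    z₀ z₁ : M2
    z₀ = z zero
    z₁ = z (suc zero)

  transferFactor-z₀ : ∀ i → K? (inv z₀ · g · z i) ≡ true →
                      transferFactor K? 2 z g i ≡ inv z₀ · g · z i
  transferFactor-z₀ i k₀ rewrite k₀ = refl

  transferFactor-z₁ : ∀ i → K? (inv z₀ · g · z i) ≡ false → K? (inv z₁ · g · z i) ≡ true →
                      transferFactor K? 2 z g i ≡ inv z₁ · g · z i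
  transferFactor-z₁ i k₀ k₁ rewrite k₀ | k₁ = refl

  transfer₂-fixing : K? (inv z₀ · g · z₀) ≡ true → K? (inv z₀ · g · z₁) ≡ false → K? (inv z₁ · g · z₁) ≡ true →
                     transfer K? 2 z g ≡ (inv z₀ · g · z₀) · (inv z₁ · g · z₁)
  transfer₂-fixing k₀₀ k₀₁ k₁₁ =
    cong₂ _·_ (transferFactor-z₀ zero k₀₀)
              (trans (cong (_· I₂) (transferFactor-z₁ (suc zero) k₀₁ k₁₁)) (·-identityʳ _))

  transfer₂-swapping : SL2 z₀ →
                       K? (inv z₀ · g · z₀) ≡ false → K? (inv z₁ · g · z₀) ≡ true → K? (inv z₀ · g · z₁) ≡ true →
                       transfer K? 2 z g ≡ inv z₁ · (g · g) · z₁
  transfer₂-swapping det≡1 k₀₀ k₁₀ k₀₁ = begin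
    transferFactor K? 2 z g zero · (transferFactor K? 2 z g (suc zero) · I₂)
      ≡⟨ cong₂ (λ f₀ f₁ → f₀ · (f₁ · I₂)) (transferFactor-z₁ zero k₀₀ k₁₀) (transferFactor-z₀ (suc zero) k₀₁) ⟩
    inv z₁ · g · z₀ · (inv z₀ · g · z₁ · I₂) ≡⟨ cong (inv z₁ · g · z₀ ·_) (·-identityʳ (inv z₀ · g · z₁)) ⟩
    inv z₁ · g · z₀ · (inv z₀ · g · z₁)      ≡⟨ cong (inv z₁ · g · z₀ ·_) (·-assoc (inv z₀) g z₁) ⟩
    inv z₁ · g · z₀ · (inv z₀ · (g · z₁))    ≡⟨ sym (·-assoc (inv z₁ · g · z₀) (inv z₀) (g · z₁)) ⟩
    inv z₁ · g · z₀ · inv z₀ · (g · z₁)      ≡⟨ cong (_· (g · z₁)) (·-cancelʳ (inv z₁ · g) z₀ det≡1) ⟩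
    inv z₁ · g · (g · z₁)                    ≡⟨ sym (·-assoc (inv z₁ · g) g z₁) ⟩
    inv z₁ · g · g · z₁                      ≡⟨ cong (_· z₁) (·-assoc (inv z₁) g g) ⟩
    inv z₁ · (g · g) · z₁                    ∎
    where open ≡-Reasoning

bijection-to-Bool⇒≡2 : ∀ {n} (f : Fin n → Bool) →
                       Injective _≡_ _≡_ f → StrictlySurjective _≡_ f → n ≡ 2
bijection-to-Bool⇒≡2 f injective surjective =
  ↔⇒≡ (↔-sym 2↔Bool ↔-∘ ⤖⇒↔ (mk⤖ {to = f} (injective , strictlySurjective⇒surjective surjective)))

canonical : Bool → M2 → M2
canonical false g = g · (inv T · g · T)
canonical true  g = g · g

xor≡false⇒≡ : ∀ p q → p xor q ≡ false → p ≡ q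
xor≡false⇒≡ false false _ = refl
xor≡false⇒≡ true  true  _ = refl
xor≡false⇒≡ false true  ()
xor≡false⇒≡ true  false ()

module IndexTwo {H : Pred} (H-sub : IsSubgroup H)
                (H-odd-diagonal : ∀ {h} → H h → a h ≡ + 1 ⟨mod 2 ⟩ × d h ≡ + 1 ⟨mod 2 ⟩)
                (T∈H : H T) (K? : ∀ h → Dec ((H ∩ Γ⁰2) h))
                {K′ : Pred} (K′-sub : IsSubgroup K′) (H∩Γ⁰2⊆K′ : ∀ {h} → (H ∩ Γ⁰2) h → K′ h) where
  open IsSubgroup H-sub
  open Abelianization K′-sub
  module K′ = IsSubgroup K′-sub

  K : Pred
  K = H ∩ Γ⁰2

  conj∈H : ∀ {x g y} → H x → H g → H y → H (inv x · g · y)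
  conj∈H hx hg hy = ·-closed (·-closed (inv-closed hx) hg) hy

  parity-· : ∀ {x y p q} → H x → H y → Parity (b x) p → Parity (b y) q → Parity (b (x · y)) (p xor q)
  parity-· {x} {y} hx hy = b-parity-· {x} {y} (proj₁ (H-odd-diagonal hx)) (proj₂ (H-odd-diagonal hy))

  parity-inv-· : ∀ {x y p q} → H x → H y → Parity (b x) p → Parity (b y) q →
                 Parity (b (inv x · y)) (p xor q)
  parity-inv-· {x} hx hy px = parity-· (inv-closed hx) hy (b-parity-inv {x} px)

  parity-conj : ∀ {x g y p q r} → H x → H g → H y → Parity (b x) p → Parity (b g) q → Parity (b y) r →
                Parity (b (inv x · g · y)) ((p xor q) xor r)
  parity-conj hx hg hy px qg = parity-· (·-closed (inv-closed hx) hg) hy (parity-inv-· hx hg px qg)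

  T-odd : Parity (b T) true
  T-odd = parity mod-refl

  even∈K : ∀ {h} → H h → Parity (b h) false → K h
  even∈K hh (parity b≡0) = hh , ⊆SL2 hh , unwrap b≡0

  even∈K′ : ∀ {h} → H h → Parity (b h) false → K′ h
  even∈K′ hh ph = H∩Γ⁰2⊆K′ (even∈K hh ph)

  K-even : ∀ {h} → K h → Parity (b h) false
  K-even (_ , _ , b≡0) = parity (wrap b≡0)

  K?-parity : ∀ {h p} → H h → Parity (b h) p → ⌊ K? h ⌋ ≡ not p
  K?-parity {h} {false} hh ph = trans (isYes≗does (K? h)) (dec-true (K? h) (even∈K hh ph))
  K?-parity {h} {true}  hh ph = trans (isYes≗does (K? h)) (dec-false (K? h) odd∉K)
    where
    odd∉K : ¬ K h
    odd∉K kh = ⊥-elim (not-¬ refl (parity-unique ph (K-even kh)))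

  coset-parity : ∀ {x h p} → H x → H h → K (inv x · h) → Parity (b h) p → Parity (b x) p
  coset-parity {x} hx hh k ph =
    let q , qx = parityOf (b x)
    in  subst (Parity (b x)) (xor≡false⇒≡ _ _ (parity-unique (parity-inv-· hx hh qx ph) (K-even k))) qx

  module Transversal {n} {z : Fin n → M2} (tr : IsLeftTransversal H K n z) where
    private
      z∈H : ∀ i → H (z i)
      z∈H = proj₁ tr
      covers : ∀ h → H h → ∃ λ i → K (inv (z i) · h)
      covers = proj₁ (proj₂ tr)
      unique : ∀ h → H h → ∀ i j → K (inv (z i) · h) → K (inv (z j) · h) → i ≡ j
      unique = proj₂ (proj₂ tr)

    same-parity⇒same-index : ∀ {i j p} → Parity (b (z i)) p → Parity (b (z j)) p → i ≡ j
    same-parity⇒same-index {i} {j} {p} pᵢ pⱼ = unique (z j) (z∈H j) i j (coset-even pᵢ pⱼ) (coset-even pⱼ pⱼ)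
      where
      coset-even : ∀ {i j} → Parity (b (z i)) p → Parity (b (z j)) p → K (inv (z i) · z j)
      coset-even {i} {j} pᵢ pⱼ = even∈K (·-closed (inv-closed (z∈H i)) (z∈H j))
        (subst (Parity _) (xor-same p) (parity-inv-· (z∈H i) (z∈H j) pᵢ pⱼ))

    index-of-parity : ∀ p → ∃ λ i → Parity (b (z i)) p
    index-of-parity false = let i , k = covers I₂ ∋I₂ in i , coset-parity (z∈H i) ∋I₂ k (parity mod-refl)
    index-of-parity true  = let i , k = covers T  T∈H in i , coset-parity (z∈H i) T∈H k T-odd

    index≡2 : n ≡ 2
    index≡2 = bijection-to-Bool⇒≡2 parity-of injective surjective
      where
      parity-of : Fin n → Bool
      parity-of i = proj₁ (parityOf (b (z i)))
      parity-of-correct : ∀ i → Parity (b (z i)) (parity-of i)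
      parity-of-correct i = proj₂ (parityOf (b (z i)))
      injective : Injective _≡_ _≡_ parity-of
      injective {i} {j} same =
        same-parity⇒same-index (parity-of-correct i) (subst (Parity (b (z j))) (sym same) (parity-of-correct j))
      surjective : StrictlySurjective _≡_ parity-of
      surjective p = let i , pᵢ = index-of-parity p in i , parity-unique (parity-of-correct i) pᵢ

  z₁-parity : ∀ {z p} → IsLeftTransversal H K 2 z → Parity (b (z zero)) p → Parity (b (z (suc zero))) (not p)
  z₁-parity {z} {p} tr p₀ = other-index (Transversal.index-of-parity tr (not p))
    where
    other-index : ∃ (λ i → Parity (b (z i)) (not p)) → Parity (b (z (suc zero))) (not p)
    other-index (suc zero , p₁)  = p₁
    other-index (zero     , p₀′) = ⊥-elim (not-¬ refl (parity-unique p₀ p₀′))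

  conj-even≈ : ∀ {x g} → H x → Parity (b x) false → H g → Parity (b g) false →
               AbEq K′ (inv x · g · x) g
  conj-even≈ hx px hg pg = AbEq-conj (even∈K′ hx px) (even∈K′ hg pg)

  conj-odd≈ : ∀ {x g} → H x → Parity (b x) true → H g → Parity (b g) false →
              AbEq K′ (inv x · g · x) (inv T · g · T)
  conj-odd≈ {x} {g} hx px hg pg = AbEq-conj-coset {x} {T} {g} (⊆SL2 T∈H)
    (even∈K′ (·-closed (inv-closed T∈H) hx) (parity-inv-· T∈H hx T-odd px))
    (even∈K′ (conj∈H T∈H hg T∈H) (parity-conj T∈H hg T∈H T-odd pg T-odd))

  conj-square≈ : ∀ {x g q} → H x → Parity (b x) q → H g → Parity (b g) true →
                 AbEq K′ (inv x · (g · g) · x) (g · g)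
  conj-square≈ {q = false} hx px hg pg = AbEq-conj (even∈K′ hx px) (even∈K′ (·-closed hg hg) (parity-· hg hg pg pg))
  conj-square≈ {x} {g} {true} hx px hg pg =
    subst (AbEq K′ (inv x · (g · g) · x)) (cong (_· g) (·-cancelˡ′ g g (⊆SL2 hg)))
      (AbEq-conj-coset {x} {g} {g · g} (⊆SL2 hg)
        (even∈K′ (·-closed (inv-closed hg) hx) (parity-inv-· hg hx pg px))
        (even∈K′ (conj∈H hg hgg hg) (parity-conj hg hgg hg pg (parity-· hg hg pg pg) pg)))
    where
    hgg : H (g · g)
    hgg = ·-closed hg hg

  canonical∈K : ∀ {g p} → H g → Parity (b g) p → K (canonical p g)
  canonical∈K {g} {false} hg pg =
    even∈K (·-closed hg hm) (parity-· hg hm pg (parity-conj T∈H hg T∈H T-odd pg T-odd))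
    where
    hm : H (inv T · g · T)
    hm = conj∈H T∈H hg T∈H
  canonical∈K {g} {true} hg pg = even∈K (·-closed hg hg) (parity-· hg hg pg pg)

  module OnTwoCosets {z : Fin 2 → M2} (tr : IsLeftTransversal H K 2 z) {g} (hg : H g) where
    private
      z₀ z₁ : M2
      z₀ = z zero
      z₁ = z (suc zero)
      z₀∈H : H z₀
      z₀∈H = proj₁ tr zero
      z₁∈H : H z₁
      z₁∈H = proj₁ tr (suc zero)

    V : M2
    V = transfer (λ h → ⌊ K? h ⌋) 2 z g

    K?-conj : ∀ {i j pᵢ p pⱼ} → Parity (b (z j)) pⱼ → Parity (b g) p → Parity (b (z i)) pᵢ →
              ⌊ K? (inv (z j) · g · z i) ⌋ ≡ not ((pⱼ xor p) xor pᵢ)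
    K?-conj {i} {j} pⱼ pg pᵢ =
      K?-parity (conj∈H (proj₁ tr j) hg (proj₁ tr i)) (parity-conj (proj₁ tr j) hg (proj₁ tr i) pⱼ pg pᵢ)

    -- In V-fixing and V-swapping the clauses for p₀ = false and p₀ = true are the same text;
    -- the split only makes the parities computed by K?-conj reduce.
    V-fixing : ∀ {p₀} → Parity (b g) false → Parity (b z₀) p₀ → V ≡ (inv z₀ · g · z₀) · (inv z₁ · g · z₁)
    V-fixing {false} pg p₀ = transfer₂-fixing (λ h → ⌊ K? h ⌋) z g
      (K?-conj p₀ pg p₀) (K?-conj p₀ pg (z₁-parity tr p₀)) (K?-conj (z₁-parity tr p₀) pg (z₁-parity tr p₀))
    V-fixing {true}  pg p₀ = transfer₂-fixing (λ h → ⌊ K? h ⌋) z g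
      (K?-conj p₀ pg p₀) (K?-conj p₀ pg (z₁-parity tr p₀)) (K?-conj (z₁-parity tr p₀) pg (z₁-parity tr p₀))

    V-swapping : ∀ {p₀} → Parity (b g) true → Parity (b z₀) p₀ → V ≡ inv z₁ · (g · g) · z₁
    V-swapping {false} pg p₀ = transfer₂-swapping (λ h → ⌊ K? h ⌋) z g (⊆SL2 z₀∈H)
      (K?-conj p₀ pg p₀) (K?-conj (z₁-parity tr p₀) pg p₀) (K?-conj p₀ pg (z₁-parity tr p₀))
    V-swapping {true}  pg p₀ = transfer₂-swapping (λ h → ⌊ K? h ⌋) z g (⊆SL2 z₀∈H)
      (K?-conj p₀ pg p₀) (K?-conj (z₁-parity tr p₀) pg p₀) (K?-conj p₀ pg (z₁-parity tr p₀))

    V≈canonical : ∀ {p p₀} → Parity (b g) p → Parity (b z₀) p₀ → AbEq K′ V (canonical p g)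
    V≈canonical {false} {false} pg p₀ =
      subst (λ v → AbEq K′ v (canonical false g)) (sym (V-fixing pg p₀))
        (AbEq-· (even∈K′ (conj∈H z₀∈H hg z₀∈H) (parity-conj z₀∈H hg z₀∈H p₀ pg p₀))
                (conj-even≈ z₀∈H p₀ hg pg) (conj-odd≈ z₁∈H (z₁-parity tr p₀) hg pg))
    V≈canonical {false} {true} pg p₀ =
      subst (λ v → AbEq K′ v (canonical false g)) (sym (V-fixing pg p₀))
        (AbEq-trans {(inv z₀ · g · z₀) · (inv z₁ · g · z₁)} {m · g} {g · m} (K′.·-closed m∈K′ g∈K′)
          (AbEq-· {inv z₀ · g · z₀} {m} {inv z₁ · g · z₁} {g}
                  (even∈K′ (conj∈H z₀∈H hg z₀∈H) (parity-conj z₀∈H hg z₀∈H p₀ pg p₀))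
                  (conj-odd≈ z₀∈H p₀ hg pg) (conj-even≈ z₁∈H (z₁-parity tr p₀) hg pg))
          (AbEq-comm m∈K′ g∈K′))
      where
      m : M2
      m = inv T · g · T
      m∈K′ : K′ m
      m∈K′ = even∈K′ (conj∈H T∈H hg T∈H) (parity-conj T∈H hg T∈H T-odd pg T-odd)
      g∈K′ : K′ g
      g∈K′ = even∈K′ hg pg
    V≈canonical {true} pg p₀ =
      subst (λ v → AbEq K′ v (g · g)) (sym (V-swapping pg p₀)) (conj-square≈ z₁∈H (z₁-parity tr p₀) hg pg)

  transfer≈canonical : ∀ {n z g p} → IsLeftTransversal H K n z → H g → Parity (b g) p →
                       AbEq K′ (transfer (λ h → ⌊ K? h ⌋) n z g) (canonical p g)
  transfer≈canonical {g = g} {p} tr hg pg = on-two-cosets (Transversal.index≡2 tr) tr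
    where
    on-two-cosets : ∀ {n z} → n ≡ 2 → IsLeftTransversal H K n z →
                    AbEq K′ (transfer (λ h → ⌊ K? h ⌋) n z g) (canonical p g)
    on-two-cosets {z = z} refl tr = OnTwoCosets.V≈canonical tr hg pg (proj₂ (parityOf (b (z zero))))

lemma3p2 : (N : ℕ) → ¬ (2 ∣ N) →
    (r s r′ s′ : ℕ) → 2 ≤ s → s ≤ r → 2 ≤ s′ → s′ ≤ r′ → r′ ≤ r → s′ ≤ s →
    (n : ℕ) (x : Fin n → M2) → IsLeftTransversal (Φ N r s) (Φ N r s ∩ Γ⁰2) n x →
    (n′ : ℕ) (x′ : Fin n′ → M2) → IsLeftTransversal (Φ N r′ s′) (Φ N r′ s′ ∩ Γ⁰2) n′ x′ →
    (g : M2) → Φ N r s g →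
    AbEq (Φ N (suc r′) s′) (U′ N r s n x g) (U′ N r′ s′ n′ x′ g)
    × AbEq (Φ N r′ s′) (U′ N r s n x g) (U′ N r′ s′ n′ x′ g)
lemma3p2 N _ r s r′ s′ 2≤s _ 2≤s′ _ r′≤r s′≤s n x tr n′ x′ tr′ g g∈Φ =
  U′≈U′ , Comm-mono (λ {h} → Φ-mono {N} (ℕP.n≤1+n r′) (ℕP.≤-refl {s′}) {h}) U′≈U′
  where
  K′ : Pred
  K′ = Φ N r′ s′ ∩ Γ⁰2
  K′-sub : IsSubgroup K′
  K′-sub = ∩-subgroup (Φ-subgroup N r′ s′) Γ⁰2-subgroup
  open Abelianization K′-sub

  module Fine   = IndexTwo (Φ-subgroup N r s) (λ {h} → Φ-odd-diagonal {N} {r} (ℕP.<⇒≤ 2≤s) {h})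
                           (T∈Φ {N} {r} {s}) (ΦΓ⁰2? N r s)
                           K′-sub (λ {h} (h∈Φ , h∈Γ⁰2) → Φ-mono {N} r′≤r s′≤s {h} h∈Φ , h∈Γ⁰2)
  module Coarse = IndexTwo (Φ-subgroup N r′ s′) (λ {h} → Φ-odd-diagonal {N} {r′} (ℕP.<⇒≤ 2≤s′) {h})
                           (T∈Φ {N} {r′} {s′}) (ΦΓ⁰2? N r′ s′)
                           K′-sub (λ k → k)

  V V′ : M2
  V  = transfer (λ h → ⌊ ΦΓ⁰2? N r s h ⌋) n x g
  V′ = transfer (λ h → ⌊ ΦΓ⁰2? N r′ s′ h ⌋) n′ x′ g
  p : Bool
  p = proj₁ (parityOf (b g))
  g-parity : Parity (b g) p
  g-parity = proj₂ (parityOf (b g))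

  g∈Φ′ : Φ N r′ s′ g
  g∈Φ′ = Φ-mono {N} r′≤r s′≤s {g} g∈Φ

  c∈K′ : K′ (canonical p g)
  c∈K′ = Coarse.canonical∈K g∈Φ′ g-parity
  V≈c : AbEq K′ V (canonical p g)
  V≈c = Fine.transfer≈canonical tr g∈Φ g-parity
  V′≈c : AbEq K′ V′ (canonical p g)
  V′≈c = Coarse.transfer≈canonical tr′ g∈Φ′ g-parity
  U′≈U′ : AbEq (Φ N (suc r′) s′) (conjT V) (conjT V′)
  U′≈U′ = AbEq-conjT {N} {r′} {s′} {V} {V′} (AbEq-closed {V} V≈c c∈K′) (AbEq-closed {V′} V′≈c c∈K′)
                     (AbEq-trans {V} {canonical p g} {V′} c∈K′ V≈c (AbEq-sym {V′} V′≈c))
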